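{- Let $n\ge 3$ be an integer such that $p=4n-1$ is prime, let $M_0=\lfloor (n^2-4n+5)/p\rfloor$, and for integers $m\ge0$ let $Q_m=\frac12+\frac12\sqrt{4mp+3p-4}$ and $k_m=1+\lfloor Q_m\rfloor$. Let $A_{\ge}=\{k\in\{2,\dots,n+2\}: r_p((k-1)^2)\ge 3n+k-3\}$. Then $k\in A_{\ge}$ if and only if there is $m\in\{0,1,\dots,M_0\}$ such that $k_m<k\le 1+\lfloor\sqrt{mp+p-1}\rfloor$.
   Context: For a positive integer $q$ and $x\in\mathbb{Z}$, $r_q(x)\in\{0,1,\dots,q-1\}$ denotes the remainder of $x$ upon division by $q$. -}

module Defs where

open import Data.Nat using (ℕ; zero; suc; _+_; _*_; _∸_; _^_; _≤_; _<_; _≤ᵇ_; NonZero)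
open import Data.Nat.DivMod using (_/_; _%_)
open import Data.Bool using (if_then_else_)
open import Data.Product using (_×_)

isqrtUpTo : ℕ → ℕ → ℕ
isqrtUpTo N zero = zero
isqrtUpTo N (suc t) = if suc t * suc t ≤ᵇ N then suc t else isqrtUpTo N t

isqrt : ℕ → ℕ
isqrt N = isqrtUpTo N N

-- M₀ = ⌊(n² − 4n + 5)/p⌋   (n² − 4n + 5 = (n−2)² + 1 > 0)
M₀ : (n p : ℕ) → .{{NonZero p}} → ℕ
M₀ n p = (n * n + 5 ∸ 4 * n) / p

-- ⌊Q_m⌋ where Q_m = 1/2 + (1/2)√(4mp+3p−4); since ⌊(1+x)/2⌋ = ⌊(1+⌊x⌋)/2⌋ for x ≥ 0
floorQ : (p m : ℕ) → ℕ
floorQ p m = (1 + isqrt (4 * m * p + 3 * p ∸ 4)) / 2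

kₘ : (p m : ℕ) → ℕ
kₘ p m = 1 + floorQ p m

InA≥ : (n p : ℕ) → .{{NonZero p}} → ℕ → Set
InA≥ n p k = (2 ≤ k) × (k ≤ n + 2) × (3 * n + k ∸ 3 ≤ ((k ∸ 1) ^ 2) % p)

-- Write J = (k − 1)² = mp + r with r < p. Membership k ∈ A_≥ says r ≥ t := 3n + k − 3, i.e.
-- mp + t ≤ J; multiplied by 4 this reads 4mp + 3p − 4 ≤ (2k − 3)², while k_m < k is the strict
-- inequality. Equality would make p divide (2k − 3)² + 4, hence (since p is odd) make −1 a square
-- modulo p, which Fermat's little theorem rules out for p ≡ 3 (mod 4). The remainder condition
-- J < (m + 1)p is k ≤ 1 + ⌊√(mp + p − 1)⌋, and the ranges k ≤ n + 2 and m ≤ M₀ force each other.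
module Submission where

open import Defs
open import Data.Nat using (ℕ; _+_; _*_; _∸_; _≤_; _<_; NonZero)
open import Data.Nat.Primality using (Prime)
open import Data.Product using (Σ; _×_)
open import Function.Bundles using (_⇔_)
open import Relation.Binary.PropositionalEquality using (_≡_)

open import Data.Bool using (true; false; T)
open import Data.Fin using (Fin; toℕ; zero; suc; inject₁; fromℕ)
open import Data.Fin.Properties using (toℕ-inject₁; toℕ-fromℕ; toℕ<n)
open import Data.Nat
open import Data.Nat.Combinatorics using (_C_; nCk+nC[k+1]≡[n+1]C[k+1]; nC1≡n; nCn≡1)
open import Data.Nat.Divisibility
open import Data.Nat.DivMod
open import Data.Nat.Primality using (euclidsLemma)
open import Data.Nat.Properties
open import Data.Nat.Tactic.RingSolver using (solve-∀)
open import Data.Product using (∃; _,_; proj₁; proj₂)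
open import Data.Sum using (inj₁; inj₂)
open import Data.Unit using (tt)
open import Function.Base using (_∘_)
open import Function.Bundles using (mk⇔; module Equivalence)
open import Relation.Nullary.Negation using (contradiction)
open import Relation.Binary.PropositionalEquality
  using (_≢_; refl; sym; trans; cong; cong₂; subst; subst₂; module ≡-Reasoning)

import Algebra.Properties.CommutativeSemiring.Binomial +-*-commutativeSemiring as Binomial
open import Algebra.Properties.Semiring.Sum +-*-semiring using (sum; sum-init-last)
open import Algebra.Properties.Semiring.Exp +-*-semiring using () renaming (_^_ to _^ₛ_)
open import Algebra.Properties.Semiring.Mult +-*-semiring using () renaming (_×_ to _×ₛ_)

open _∣_ using (quotient; equality)

[k+1]*[n+1]C[k+1]≡[n+1]*nCk : ∀ n k → suc k * (suc n C suc k) ≡ suc n * (n C k)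
[k+1]*[n+1]C[k+1]≡[n+1]*nCk zero    zero    = refl
[k+1]*[n+1]C[k+1]≡[n+1]*nCk zero    (suc k) = *-zeroʳ (2 + k)
[k+1]*[n+1]C[k+1]≡[n+1]*nCk (suc n) zero    =
  trans (*-identityˡ _) (trans (nC1≡n (2 + n)) (sym (*-identityʳ (2 + n))))
[k+1]*[n+1]C[k+1]≡[n+1]*nCk (suc n) (suc k) = begin
  (2 + k) * ((2 + n) C (2 + k))                 ≡⟨ cong ((2 + k) *_) (nCk+nC[k+1]≡[n+1]C[k+1] (suc n) (suc k)) ⟨
  (2 + k) * (X + Y)                             ≡⟨ split (1 + k) X Y ⟩
  X + (1 + k) * X + (2 + k) * Y                 ≡⟨ cong₂ (λ u v → X + u + v) ([k+1]*[n+1]C[k+1]≡[n+1]*nCk n k)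
                                                                            ([k+1]*[n+1]C[k+1]≡[n+1]*nCk n (suc k)) ⟩
  X + (1 + n) * (n C k) + (1 + n) * (n C suc k) ≡⟨ collect (1 + n) X (n C k) (n C suc k) ⟩
  X + (1 + n) * (n C k + n C suc k)             ≡⟨ cong (λ u → X + (1 + n) * u) (nCk+nC[k+1]≡[n+1]C[k+1] n k) ⟩
  (2 + n) * X                                   ∎
  where
  open ≡-Reasoning
  X = (1 + n) C (1 + k)
  Y = (1 + n) C (2 + k)
  split : ∀ k X Y → (1 + k) * (X + Y) ≡ X + k * X + (1 + k) * Y
  split = solve-∀
  collect : ∀ n X U V → X + n * U + n * V ≡ X + n * (U + V)
  collect = solve-∀

prime∣pCk : ∀ {p k} → Prime p → 0 < k → k < p → p ∣ p C k
prime∣pCk {suc q} {suc j} p-prime _ k<p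
  with euclidsLemma (suc j) _ p-prime (divides (q C j) (trans ([k+1]*[n+1]C[k+1]≡[n+1]*nCk q j) (*-comm (suc q) (q C j))))
... | inj₁ p∣k = contradiction p∣k (>⇒∤ k<p)
... | inj₂ p∣C = p∣C

×ₛ≡* : ∀ m x → m ×ₛ x ≡ m * x
×ₛ≡* zero    x = refl
×ₛ≡* (suc m) x = cong (x +_) (×ₛ≡* m x)

^ₛ≡^ : ∀ x m → x ^ₛ m ≡ x ^ m
^ₛ≡^ x zero    = refl
^ₛ≡^ x (suc m) = cong (x *_) (^ₛ≡^ x m)

∣-sum : ∀ {d n} (t : Fin n → ℕ) → (∀ i → d ∣ t i) → d ∣ sum t
∣-sum {d} {zero}  t _      = d ∣0
∣-sum {n = suc n} t d∣t[i] = ∣m∣n⇒∣m+n (d∣t[i] zero) (∣-sum (t ∘ suc) (d∣t[i] ∘ suc))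

freshmansDream : ∀ {p} → Prime p → ∀ a → ∃ λ s → (1 + a) ^ p ≡ 1 + a ^ p + s * p
freshmansDream {suc q} p-prime a = s , (begin
  (1 + a) ^ p                                ≡⟨ expansion ⟩
  term zero + (sum middle + term (suc top))  ≡⟨ cong₂ (λ u v → u + (v + term (suc top))) first middle≡sp ⟩
  a ^ p + (s * p + term (suc top))           ≡⟨ cong (λ u → a ^ p + (s * p + u)) last ⟩
  a ^ p + (s * p + 1)                        ≡⟨ shuffle (a ^ p) (s * p) ⟩
  1 + a ^ p + s * p                          ∎)
  where
  open ≡-Reasoning
  p = suc q
  top = fromℕ q
  term : Fin (suc p) → ℕ
  term = Binomial.binomialTerm 1 a p
  middle : Fin q → ℕ
  middle = term ∘ suc ∘ inject₁
  term≡ : ∀ k → term k ≡ (p C toℕ k) * (1 ^ toℕ k * a ^ (p ∸ toℕ k))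
  term≡ k = trans (×ₛ≡* (p C toℕ k) _)
                  (cong₂ (λ u v → (p C toℕ k) * (u * v)) (^ₛ≡^ 1 (toℕ k)) (^ₛ≡^ a (p ∸ toℕ k)))
  expansion : (1 + a) ^ p ≡ term zero + (sum middle + term (suc top))
  expansion = trans (sym (^ₛ≡^ (1 + a) p))
                    (trans (Binomial.theorem p 1 a) (cong (term zero +_) (sum-init-last (term ∘ suc))))
  first : term zero ≡ a ^ p
  first = trans (term≡ zero) (trans (*-identityˡ _) (*-identityˡ _))
  last : term (suc top) ≡ 1
  last rewrite term≡ (suc top) | toℕ-fromℕ q | nCn≡1 p | ^-zeroˡ p | n∸n≡0 p = refl
  p∣middle : ∀ j → p ∣ middle j
  p∣middle j rewrite term≡ (suc (inject₁ j)) =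
    ∣m⇒∣m*n _ (prime∣pCk p-prime z<s (s<s (subst (_< q) (sym (toℕ-inject₁ j)) (toℕ<n j))))
  p∣sum : p ∣ sum middle
  p∣sum = ∣-sum middle p∣middle
  s : ℕ
  s = quotient p∣sum
  middle≡sp : sum middle ≡ s * p
  middle≡sp = equality p∣sum
  shuffle : ∀ x y → x + (y + 1) ≡ 1 + x + y
  shuffle = solve-∀

fermatsLittleTheorem : ∀ {p} → Prime p → ∀ a → ∃ λ s → a ^ p ≡ a + s * p
fermatsLittleTheorem {suc q} _ zero = 0 , refl
fermatsLittleTheorem {p} p-prime (suc a)
  with freshmansDream p-prime a | fermatsLittleTheorem p-prime a
... | s , dream | t , fermat = s + t , (begin
  (1 + a) ^ p             ≡⟨ dream ⟩
  1 + a ^ p + s * p       ≡⟨ cong (λ u → 1 + u + s * p) fermat ⟩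
  1 + (a + t * p) + s * p ≡⟨ collect a s t p ⟩
  1 + a + (s + t) * p     ∎)
  where
  open ≡-Reasoning
  collect : ∀ a s t p → 1 + (a + t * p) + s * p ≡ 1 + a + (s + t) * p
  collect = solve-∀

^-odd : ∀ y e → y ^ (1 + 2 * e) ≡ y * (y * y) ^ e
^-odd y e = cong (y *_) (trans (sym (^-*-assoc y 2 e)) (cong (_^ e) (cong (y *_) (*-identityʳ y))))

x+1∣x^[1+2e]+1 : ∀ x e → x + 1 ∣ x ^ (1 + 2 * e) + 1
x+1∣x^[1+2e]+1 x zero = subst (λ u → x + 1 ∣ u + 1) (sym (*-identityʳ x)) ∣-refl
x+1∣x^[1+2e]+1 x (suc e) =
  ∣m+n∣m⇒∣n (subst (x + 1 ∣_) identity (∣m∣n⇒∣m+n (∣n⇒∣m*n (x * x) (x+1∣x^[1+2e]+1 x e)) ∣-refl))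
            (∣n⇒∣m*n x ∣-refl)
  where
  u = x ^ (1 + 2 * e)
  regroup : ∀ x u → x * x * (u + 1) + (x + 1) ≡ x * (x + 1) + (x * (x * u) + 1)
  regroup = solve-∀
  exponent : ∀ e → 2 + (1 + 2 * e) ≡ 1 + 2 * suc e
  exponent = solve-∀
  identity : x * x * (u + 1) + (x + 1) ≡ x * (x + 1) + (x ^ (1 + 2 * suc e) + 1)
  identity = trans (regroup x u) (cong (λ v → x * (x + 1) + (x ^ v + 1)) (exponent e))

prime>2⇒∣2*m⇒∣m : ∀ {p m} → Prime p → 2 < p → p ∣ 2 * m → p ∣ m
prime>2⇒∣2*m⇒∣m {m = m} p-prime 2<p p∣2m with euclidsLemma 2 m p-prime p∣2m
... | inj₁ p∣2 = contradiction p∣2 (>⇒∤ 2<p)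
... | inj₂ p∣m = p∣m

-- If y² ≡ −1 then y^p = y (y²)^((p−1)/2) ≡ −y, while Fermat gives y^p ≡ y; hence p ∣ 2y.
prime≡3mod4⇒∤y²+1 : ∀ {p c} → Prime p → p ≡ 3 + 4 * c → ∀ y → p ∤ y * y + 1
prime≡3mod4⇒∤y²+1 {p} {c} p-prime refl y p∣y²+1 =
  contradiction (∣m+n∣m⇒∣n p∣y²+1 (∣m⇒∣m*n y p∣y)) (>⇒∤ (s≤s (s≤s z≤n)))
  where
  a = y * y
  e = 1 + 2 * c
  s = proj₁ (fermatsLittleTheorem p-prime y)
  p∣a^e+1 : p ∣ a ^ e + 1
  p∣a^e+1 = ∣-trans p∣y²+1 (x+1∣x^[1+2e]+1 a c)
  y[a^e+1]≡2y+sp : y * (a ^ e + 1) ≡ s * p + 2 * y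
  y[a^e+1]≡2y+sp = begin
    y * (a ^ e + 1)     ≡⟨ *-distribˡ-+ y (a ^ e) 1 ⟩
    y * a ^ e + y * 1   ≡⟨ cong₂ _+_ (sym (^-odd y e)) (*-identityʳ y) ⟩
    y ^ (1 + 2 * e) + y ≡⟨ cong (λ v → y ^ v + y) (exponent c) ⟩
    y ^ p + y           ≡⟨ cong (_+ y) (proj₂ (fermatsLittleTheorem p-prime y)) ⟩
    y + s * p + y       ≡⟨ collect y (s * p) ⟩
    s * p + 2 * y       ∎
    where
    open ≡-Reasoning
    exponent : ∀ c → 1 + 2 * (1 + 2 * c) ≡ 3 + 4 * c
    exponent = solve-∀
    collect : ∀ y z → y + z + y ≡ z + 2 * y
    collect = solve-∀
  p∣y : p ∣ y
  p∣y = prime>2⇒∣2*m⇒∣m p-prime (s≤s (s≤s (s≤s z≤n)))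
          (∣m+n∣m⇒∣n (subst (p ∣_) y[a^e+1]≡2y+sp (∣n⇒∣m*n y p∣a^e+1)) (n∣m*n s))

prime∣x²+4⇒∣y²+1 : ∀ {p x y} → Prime p → 2 < p → 2 * y ≡ x + p → p ∣ x * x + 4 → p ∣ y * y + 1
prime∣x²+4⇒∣y²+1 {p} {x} {y} p-prime 2<p 2y≡x+p p∣x²+4 =
  prime>2⇒∣2*m⇒∣m p-prime 2<p (prime>2⇒∣2*m⇒∣m p-prime 2<p
    (subst (p ∣_) identity (∣m∣n⇒∣m+n p∣x²+4 (n∣m*n (2 * x + p)))))
  where
  expand : ∀ x p → x * x + 4 + (2 * x + p) * p ≡ (x + p) * (x + p) + 4
  expand = solve-∀
  double : ∀ y → 2 * y * (2 * y) + 4 ≡ 2 * (2 * (y * y + 1))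
  double = solve-∀
  identity : x * x + 4 + (2 * x + p) * p ≡ 2 * (2 * (y * y + 1))
  identity = trans (expand x p) (trans (cong (λ z → z * z + 4) (sym 2y≡x+p)) (double y))

prime≡3mod4⇒∤[1+2i]²+4 : ∀ {p c} → Prime p → p ≡ 3 + 4 * c → ∀ i → p ∤ (1 + 2 * i) * (1 + 2 * i) + 4
prime≡3mod4⇒∤[1+2i]²+4 {p} {c} p-prime p≡ i =
  prime≡3mod4⇒∤y²+1 {c = c} p-prime p≡ y ∘ prime∣x²+4⇒∣y²+1 {y = y} p-prime 2<p halve
  where
  y = i + 2 * c + 2
  2<p : 2 < p
  2<p = subst (2 <_) (sym p≡) (s≤s (s≤s (s≤s z≤n)))
  halve : 2 * y ≡ 1 + 2 * i + p
  halve = trans (shift i c) (cong (1 + 2 * i +_) (sym p≡))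
    where
    shift : ∀ i c → 2 * (i + 2 * c + 2) ≡ 1 + 2 * i + (3 + 4 * c)
    shift = solve-∀

isqrtUpTo-sq≤ : ∀ N t → isqrtUpTo N t * isqrtUpTo N t ≤ N
isqrtUpTo-sq≤ N zero = z≤n
isqrtUpTo-sq≤ N (suc t) with suc t * suc t ≤ᵇ N in test
... | true  = ≤ᵇ⇒≤ (suc t * suc t) N (subst T (sym test) tt)
... | false = isqrtUpTo-sq≤ N t

isqrtUpTo-maximal : ∀ N t {s} → s ≤ t → s * s ≤ N → s ≤ isqrtUpTo N t
isqrtUpTo-maximal N zero s≤t _ = s≤t
isqrtUpTo-maximal N (suc t) s≤t s²≤N with suc t * suc t ≤ᵇ N in test | m≤n⇒m<n∨m≡n s≤t
... | true  | _          = s≤t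
... | false | inj₁ s<1+t = isqrtUpTo-maximal N t (s≤s⁻¹ s<1+t) s²≤N
... | false | inj₂ refl  = contradiction (subst T test (≤⇒≤ᵇ s²≤N)) (λ ())

≤isqrt⇒sq≤ : ∀ {N s} → s ≤ isqrt N → s * s ≤ N
≤isqrt⇒sq≤ {N} s≤ = ≤-trans (*-mono-≤ s≤ s≤) (isqrtUpTo-sq≤ N N)

sq≤⇒≤isqrt : ∀ {N s} → s * s ≤ N → s ≤ isqrt N
sq≤⇒≤isqrt {N} {zero} _ = z≤n
sq≤⇒≤isqrt {N} {suc s} s²≤N = isqrtUpTo-maximal N N (≤-trans (m≤m*n (suc s) (suc s)) s²≤N) s²≤N

*≤⇒≤/ : ∀ {m n o} .{{_ : NonZero n}} → m * n ≤ o → m ≤ o / n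
*≤⇒≤/ {m} {n} m*n≤o = subst (_≤ _ / n) (m*n/n≡m m n) (/-monoˡ-≤ n m*n≤o)

[1+isqrt]/2<⇔ : ∀ X i → (1 + isqrt X) / 2 < suc i ⇔ X < (1 + 2 * i) * (1 + 2 * i)
[1+isqrt]/2<⇔ X i = mk⇔ to from
  where
  double : ∀ i → suc i * 2 ≡ suc (1 + 2 * i)
  double = solve-∀
  to : (1 + isqrt X) / 2 < suc i → X < (1 + 2 * i) * (1 + 2 * i)
  to half< = ≰⇒> λ sq≤X →
    <⇒≱ half< (*≤⇒≤/ (subst (_≤ 1 + isqrt X) (sym (double i)) (s≤s (sq≤⇒≤isqrt sq≤X))))
  from : X < (1 + 2 * i) * (1 + 2 * i) → (1 + isqrt X) / 2 < suc i
  from X<sq = m<n*o⇒m/o<n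
    (subst (1 + isqrt X <_) (sym (double i)) (s<s (≰⇒> λ le → <⇒≱ X<sq (≤isqrt⇒sq≤ le))))

%-window : ∀ {J m q} → m * suc q ≤ J → J ≤ m * suc q + q → J % suc q ≡ J ∸ m * suc q
%-window {J} {m} {q} mp≤J J≤mp+q = begin
  J % suc q              ≡⟨ m*n≤o⇒[o∸m*n]%n≡o%n m mp≤J ⟨
  (J ∸ m * suc q) % suc q ≡⟨ m<n⇒m%n≡m (s≤s rest≤q) ⟩
  J ∸ m * suc q          ∎
  where
  open ≡-Reasoning
  rest≤q : J ∸ m * suc q ≤ q
  rest≤q = subst (J ∸ m * suc q ≤_) (m+n∸m≡n (m * suc q) q) (∸-monoˡ-≤ (m * suc q) J≤mp+q)

-- n = 3 + d and k = 2 + i, so p = 11 + 4d, the threshold 3n + k − 3 is 3d + 8 + i,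
-- (k − 1)² = (1 + i)², 2k − 3 = 1 + 2i, and bound = n² − 4n + 5 is the numerator of M₀.
module Characterisation (d : ℕ) where

  p : ℕ
  p = 11 + 4 * d

  threshold : ℕ → ℕ
  threshold i = 3 * d + 8 + i

  bound : ℕ
  bound = d * d + 2 * d + 2

  X : ℕ → ℕ
  X m = 4 * m * p + 3 * p ∸ 4

  4n∸1≡p : 4 * (3 + d) ∸ 1 ≡ p
  4n∸1≡p = cong (_∸ 1) (expand d)
    where
    expand : ∀ d → 4 * (3 + d) ≡ 1 + (11 + 4 * d)
    expand = solve-∀

  p≡3+4[2+d] : p ≡ 3 + 4 * (2 + d)
  p≡3+4[2+d] = expand d
    where
    expand : ∀ d → 11 + 4 * d ≡ 3 + 4 * (2 + d)
    expand = solve-∀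

  threshold≡ : ∀ i → 3 * (3 + d) + (2 + i) ∸ 3 ≡ threshold i
  threshold≡ i = cong (_∸ 3) (expand d i)
    where
    expand : ∀ d i → 3 * (3 + d) + (2 + i) ≡ 3 + (3 * d + 8 + i)
    expand = solve-∀

  [k-1]²≡ : ∀ i → (2 + i ∸ 1) ^ 2 ≡ suc i * suc i
  [k-1]²≡ i = cong (suc i *_) (*-identityʳ (suc i))

  M₀≡ : M₀ (3 + d) p ≡ bound / p
  M₀≡ = cong (_/ p) (trans (cong (_∸ 4 * (3 + d)) (expand d)) (m+n∸m≡n (4 * (3 + d)) bound))
    where
    expand : ∀ d → (3 + d) * (3 + d) + 5 ≡ 4 * (3 + d) + (d * d + 2 * d + 2)
    expand = solve-∀

  X≡ : ∀ m → X m ≡ 4 * (m * p) + 12 * d + 29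
  X≡ m = cong (_∸ 4) (expand d m)
    where
    expand : ∀ d m → 4 * m * (11 + 4 * d) + 3 * (11 + 4 * d)
                   ≡ 4 + (4 * (m * (11 + 4 * d)) + 12 * d + 29)
    expand = solve-∀

  X+4≡[4m+3]p : ∀ m → X m + 4 ≡ (4 * m + 3) * p
  X+4≡[4m+3]p m = trans (cong (_+ 4) (X≡ m)) (expand d m)
    where
    expand : ∀ d m → 4 * (m * (11 + 4 * d)) + 12 * d + 29 + 4 ≡ (4 * m + 3) * (11 + 4 * d)
    expand = solve-∀

  -- Multiplied by 4, the threshold condition becomes the comparison defining kₘ:
  -- both sides below exceed X m and (2i + 1)² by the same 4i + 3.
  4[threshold+mp]≡X+[4i+3] : ∀ m i → 4 * (threshold i + m * p) ≡ X m + (4 * i + 3)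
  4[threshold+mp]≡X+[4i+3] m i = trans (expand d i (m * p)) (cong (_+ (4 * i + 3)) (sym (X≡ m)))
    where
    expand : ∀ d i P → 4 * (3 * d + 8 + i + P) ≡ 4 * P + 12 * d + 29 + (4 * i + 3)
    expand = solve-∀

  4[1+i]²≡[1+2i]²+[4i+3] : ∀ i → 4 * (suc i * suc i) ≡ (1 + 2 * i) * (1 + 2 * i) + (4 * i + 3)
  4[1+i]²≡[1+2i]²+[4i+3] = solve-∀

  threshold+mp≤[1+i]²⇒X≤[1+2i]² : ∀ m i → threshold i + m * p ≤ suc i * suc i →
                                  X m ≤ (1 + 2 * i) * (1 + 2 * i)
  threshold+mp≤[1+i]²⇒X≤[1+2i]² m i le = +-cancelʳ-≤ (4 * i + 3) _ _
    (subst₂ _≤_ (4[threshold+mp]≡X+[4i+3] m i) (4[1+i]²≡[1+2i]²+[4i+3] i) (*-monoʳ-≤ 4 le))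

  X<[1+2i]²⇒threshold+mp<[1+i]² : ∀ m i → X m < (1 + 2 * i) * (1 + 2 * i) →
                                  threshold i + m * p < suc i * suc i
  X<[1+2i]²⇒threshold+mp<[1+i]² m i lt = *-cancelˡ-< 4 _ _
    (subst₂ _<_ (sym (4[threshold+mp]≡X+[4i+3] m i)) (sym (4[1+i]²≡[1+2i]²+[4i+3] i))
                (+-monoˡ-< (4 * i + 3) lt))

  kₘ<2+i⇔X<[1+2i]² : ∀ m i → kₘ p m < 2 + i ⇔ X m < (1 + 2 * i) * (1 + 2 * i)
  kₘ<2+i⇔X<[1+2i]² m i = mk⇔ (to ∘ s<s⁻¹) (s<s ∘ from)
    where open Equivalence ([1+isqrt]/2<⇔ (X m) i)

  ≤M₀⇒*p≤bound : ∀ {m} → m ≤ M₀ (3 + d) p → m * p ≤ bound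
  ≤M₀⇒*p≤bound {m} m≤ = ≤-trans (*-monoˡ-≤ p (subst (m ≤_) M₀≡ m≤)) (m/n*n≤m bound p)

  *p≤bound⇒≤M₀ : ∀ {m} → m * p ≤ bound → m ≤ M₀ (3 + d) p
  *p≤bound⇒≤M₀ {m} le = subst (m ≤_) (sym M₀≡) (*≤⇒≤/ le)

  *p+p∸1≡ : ∀ m → m * p + p ∸ 1 ≡ m * p + (10 + 4 * d)
  *p+p∸1≡ m = cong (_∸ 1) (+-suc (m * p) (10 + 4 * d))

  threshold<p⇒i≤2+d : ∀ {i} → threshold i < p → i ≤ 2 + d
  threshold<p⇒i≤2+d {i} t<p =
    s≤s⁻¹ (+-cancelˡ-< (3 * d + 8) i (3 + d) (subst (threshold i <_) (split d) t<p))
    where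
    split : ∀ d → 11 + 4 * d ≡ 3 * d + 8 + (3 + d)
    split = solve-∀

  threshold+P≤[1+i]²⇒P≤bound : ∀ {i P} → i ≤ 2 + d → threshold i + P ≤ suc i * suc i → P ≤ bound
  threshold+P≤[1+i]²⇒P≤bound {i} {P} i≤ le =
    +-cancelʳ-≤ (3 * d + 7) P bound (≤-trans P+3d+7≤ (subst ((2 + d) * (3 + d) ≤_) (expand₂ d) (m≤m+n _ 3)))
    where
    open ≤-Reasoning
    expand₁ : ∀ d i P → P + (3 * d + 7) + suc i ≡ 3 * d + 8 + i + P
    expand₁ = solve-∀
    expand₂ : ∀ d → (2 + d) * (3 + d) + 3 ≡ d * d + 2 * d + 2 + (3 * d + 7)
    expand₂ = solve-∀
    P+3d+7≤ : P + (3 * d + 7) ≤ (2 + d) * (3 + d)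
    P+3d+7≤ = +-cancelʳ-≤ (suc i) _ _ (begin
      P + (3 * d + 7) + suc i      ≡⟨ expand₁ d i P ⟩
      threshold i + P             ≤⟨ le ⟩
      suc i + i * suc i           ≤⟨ +-monoʳ-≤ (suc i) (*-mono-≤ i≤ (s≤s i≤)) ⟩
      suc i + (2 + d) * (3 + d)   ≡⟨ +-comm (suc i) _ ⟩
      (2 + d) * (3 + d) + suc i   ∎)

  [1+i]²≤bound+p∸1⇒i≤3+d : ∀ {i} → suc i * suc i ≤ bound + (10 + 4 * d) → i ≤ 3 + d
  [1+i]²≤bound+p∸1⇒i≤3+d {i} le = ≮⇒≥ λ 3+d<i →
    m+1+n≰m _ (subst (_≤ bound + (10 + 4 * d)) (expand d) (≤-trans (*-mono-≤ (s≤s 3+d<i) (s≤s 3+d<i)) le))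
    where
    expand : ∀ d → (5 + d) * (5 + d) ≡ d * d + 2 * d + 2 + (10 + 4 * d) + suc (4 * d + 12)
    expand = solve-∀

  InWindow : ℕ → ℕ → Set
  InWindow k m = (m ≤ M₀ (3 + d) p) × (kₘ p m < k) × (k ≤ 1 + isqrt (m * p + p ∸ 1))

  A≥⇒window : Prime p → ∀ i → InA≥ (3 + d) p (2 + i) → Σ ℕ (InWindow (2 + i))
  A≥⇒window p-prime i (_ , _ , above) =
    m , *p≤bound⇒≤M₀ (threshold+P≤[1+i]²⇒P≤bound i≤2+d t+mp≤J) , kₘ< , s≤s (sq≤⇒≤isqrt J≤)
    where
    J = suc i * suc i
    m = J / p
    r = J % p
    J≡r+mp : J ≡ r + m * p
    J≡r+mp = m≡m%n+[m/n]*n J p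
    r<p : r < p
    r<p = m%n<n J p
    t≤r : threshold i ≤ r
    t≤r = subst₂ _≤_ (threshold≡ i) (cong (_% p) ([k-1]²≡ i)) above
    i≤2+d : i ≤ 2 + d
    i≤2+d = threshold<p⇒i≤2+d (≤-<-trans t≤r r<p)
    t+mp≤J : threshold i + m * p ≤ J
    t+mp≤J = subst (threshold i + m * p ≤_) (sym J≡r+mp) (+-monoˡ-≤ (m * p) t≤r)
    X≢[1+2i]² : X m ≢ (1 + 2 * i) * (1 + 2 * i)
    X≢[1+2i]² X≡ = prime≡3mod4⇒∤[1+2i]²+4 {c = 2 + d} p-prime p≡3+4[2+d] i
      (divides (4 * m + 3) (trans (cong (_+ 4) (sym X≡)) (X+4≡[4m+3]p m)))
    kₘ< : kₘ p m < 2 + i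
    kₘ< = Equivalence.from (kₘ<2+i⇔X<[1+2i]² m i)
      (≤∧≢⇒< (threshold+mp≤[1+i]²⇒X≤[1+2i]² m i t+mp≤J) X≢[1+2i]²)
    J≤ : J ≤ m * p + p ∸ 1
    J≤ = subst₂ _≤_ (sym J≡r+mp) (trans (+-comm (10 + 4 * d) (m * p)) (sym (*p+p∸1≡ m)))
      (+-monoˡ-≤ (m * p) (s≤s⁻¹ r<p))

  window⇒A≥ : ∀ i m → InWindow (2 + i) m → InA≥ (3 + d) p (2 + i)
  window⇒A≥ i m (m≤M₀ , kₘ< , s≤s 1+i≤) =
    s≤s (s≤s z≤n) , k≤n+2 , subst₂ _≤_ (sym (threshold≡ i)) (cong (_% p) (sym ([k-1]²≡ i))) t≤r
    where
    J = suc i * suc i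
    J≤ : J ≤ m * p + (10 + 4 * d)
    J≤ = subst (J ≤_) (*p+p∸1≡ m) (≤isqrt⇒sq≤ 1+i≤)
    t+mp<J : threshold i + m * p < J
    t+mp<J = X<[1+2i]²⇒threshold+mp<[1+i]² m i (Equivalence.to (kₘ<2+i⇔X<[1+2i]² m i) kₘ<)
    mp≤J : m * p ≤ J
    mp≤J = ≤-trans (m≤n+m (m * p) (threshold i)) (<⇒≤ t+mp<J)
    t≤r : threshold i ≤ J % p
    t≤r = subst (threshold i ≤_) (sym (%-window {m = m} {q = 10 + 4 * d} mp≤J J≤))
                (m+n≤o⇒m≤o∸n (threshold i) (<⇒≤ t+mp<J))
    k≤n+2 : 2 + i ≤ 3 + d + 2
    k≤n+2 = subst (2 + i ≤_) (+-comm 2 (3 + d))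
      (s≤s (s≤s ([1+i]²≤bound+p∸1⇒i≤3+d (≤-trans J≤ (+-monoˡ-≤ (10 + 4 * d) (≤M₀⇒*p≤bound m≤M₀))))))

  characterisation : Prime p → ∀ k → InA≥ (3 + d) p k ⇔ Σ ℕ (InWindow k)
  characterisation _ 0 = mk⇔ (λ ()) (λ ())
  characterisation _ 1 = mk⇔ (λ { (s≤s () , _) }) (λ { (_ , _ , s≤s () , _) })
  characterisation p-prime (suc (suc i)) = mk⇔ (A≥⇒window p-prime i) (λ (m , w) → window⇒A≥ i m w)

lemma3p5 : (n p : ℕ) → 3 ≤ n → p ≡ 4 * n ∸ 1 → Prime p → .{{_ : NonZero p}} →
    (k : ℕ) →
      InA≥ n p k ⇔ Σ ℕ (λ m → (m ≤ M₀ n p) × (kₘ p m < k) × (k ≤ 1 + isqrt (m * p + p ∸ 1)))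
lemma3p5 (suc (suc (suc d))) p (s≤s (s≤s (s≤s z≤n))) p≡4n∸1 p-prime k
  with trans p≡4n∸1 (Characterisation.4n∸1≡p d)
... | refl = Characterisation.characterisation d p-prime k
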